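{- Let $I$ be an instance of the preemptive setup model with $m$ machines, $\varepsilon\in(0,1)$, $T>0$, and $\delta\in\{\varepsilon^1,\dots,\varepsilon^{2/\varepsilon^2}\}$; put $\mu=\varepsilon^2\delta$. Let $\mathcal{J}^{\mathrm{mst}}$ be the set of jobs with $\mu T\le s_j<\delta T$, and assume $\sum_{j\in\mathcal{J}^{\mathrm{mst}}}(s_j+p_j)\le m\varepsilon T$. Let $I_1$ be obtained from $I$ by removing all jobs $j\in\mathcal{J}^{\mathrm{mst}}$ with $p_j<\varepsilon T$. If there is a schedule with makespan at most $T$ for $I$, there is also such a schedule for $I_1$; and for every $T'>0$, if there is a schedule with makespan at most $T'$ for $I_1$, there is a schedule with makespan at most $T'+(\varepsilon+\delta)T$ for $I$.
   Context: Preemptive setup model: jobs with processing times $p_j>0$ and setup times $s_j>0$, $m$ identical machines. A schedule splits each job $j$ into finitely many parts with processing lengths $\lambda_j(k)p_j$, $\lambda_j(k)\in(0,1]$, $\sum_k\lambda_j(k)=1$, and assigns each part a machine and a start time; the part occupies on its machine an interval of length $s_j+\lambda_j(k)p_j$ (setup followed by processing). Parts on the same machine, and parts of the same job, must not overlap in time. The makespan is the latest end time of a part.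
   Formalization: The processing times $p_j$ and setup times $s_j$, the numbers $\varepsilon$, $T$ and $T'$, and the fractions $\lambda_j(k)$ and start times of all schedules are rational. -}

module Defs where

open import Data.Nat as ℕ using (ℕ; zero; suc)
open import Data.Fin using (Fin)
open import Data.Fin.Properties using () renaming (_≟_ to _≟ᶠ_)
open import Data.List using (List; []; _∷_; length; lookup; filter; map; foldr)
open import Data.Product using (_×_; _,_; proj₁; proj₂; ∃; ∃-syntax)
open import Data.Sum using (_⊎_)
open import Data.Rational using (ℚ; 0ℚ; 1ℚ; _+_; _*_; _≤_; _<_)
open import Data.Rational.Properties using (_≤?_; _<?_)
open import Relation.Binary.PropositionalEquality using (_≡_; _≢_)
open import Relation.Nullary.Decidable using (¬?; _×-dec_)
open import Relation.Nullary using (¬_)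
open import Relation.Unary using (Decidable)

Job : Set
Job = ℚ × ℚ

proc setup : Job → ℚ
proc = proj₁
setup = proj₂

record Instance : Set where
  constructor inst
  field
    machines : ℕ
    jobs     : List Job
open Instance public

JobIdx : Instance → Set
JobIdx I = Fin (length (jobs I))

pJ sJ : (I : Instance) → JobIdx I → ℚ
pJ I j = proc (lookup (jobs I) j)
sJ I j = setup (lookup (jobs I) j)

WellFormed : Instance → Set
WellFormed I = ∀ (j : JobIdx I) → (0ℚ < pJ I j) × (0ℚ < sJ I j)

sumℚ : List ℚ → ℚ
sumℚ = foldr _+_ 0ℚ

_^_ : ℚ → ℕ → ℚ
x ^ zero  = 1ℚ
x ^ suc k = x * (x ^ k)

record Part (I : Instance) : Set where
  constructor part
  field
    job   : JobIdx I
    frac  : ℚ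
    mach  : Fin (machines I)
    start : ℚ
open Part public

endT : {I : Instance} → Part I → ℚ
endT {I} q = start q + (sJ I (job q) + frac q * pJ I (job q))

Disjoint : {I : Instance} → Part I → Part I → Set
Disjoint q r = (endT q ≤ start r) ⊎ (endT r ≤ start q)

record IsSchedule (I : Instance) (ps : List (Part I)) : Set where
  field
    fracPos    : ∀ (a : Fin (length ps)) → 0ℚ < frac (lookup ps a)
    fracLe1    : ∀ (a : Fin (length ps)) → frac (lookup ps a) ≤ 1ℚ
    startNonneg : ∀ (a : Fin (length ps)) → 0ℚ ≤ start (lookup ps a)
    fracSum    : ∀ (j : JobIdx I) →
                 sumℚ (map frac (filter (λ q → job q ≟ᶠ j) ps)) ≡ 1ℚ
    machDisj   : ∀ (a b : Fin (length ps)) → a ≢ b →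
                 mach (lookup ps a) ≡ mach (lookup ps b) →
                 Disjoint (lookup ps a) (lookup ps b)
    jobDisj    : ∀ (a b : Fin (length ps)) → a ≢ b →
                 job (lookup ps a) ≡ job (lookup ps b) →
                 Disjoint (lookup ps a) (lookup ps b)

HasScheduleWithin : Instance → ℚ → Set
HasScheduleWithin I T =
  ∃[ ps ] (IsSchedule I ps × (∀ (a : Fin (length ps)) → endT (lookup ps a) ≤ T))

isMst? : (μ δ T : ℚ) → Decidable (λ (j : Job) → (μ * T ≤ setup j) × (setup j < δ * T))
isMst? μ δ T j = ((μ * T) ≤? setup j) ×-dec (setup j <? (δ * T))

removed? : (ε μ δ T : ℚ) → Decidable (λ (j : Job) →
             (μ * T ≤ setup j) × (setup j < δ * T) × (proc j < ε * T))
removed? ε μ δ T j = ((μ * T) ≤? setup j) ×-dec ((setup j <? (δ * T)) ×-dec (proc j <? (ε * T)))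

reduce : (ε μ δ T : ℚ) → Instance → Instance
reduce ε μ δ T I = inst (machines I) (filter (λ j → ¬? (removed? ε μ δ T j)) (jobs I))

mstLoad : (μ δ T : ℚ) → Instance → ℚ
mstLoad μ δ T I = sumℚ (map (λ j → setup j + proc j) (filter (isMst? μ δ T) (jobs I)))

-- Restricting a schedule of I to the jobs of I₁ keeps it feasible. Conversely, every removed
-- job has s_j < δT and p_j < εT, and all of them together have load Σ (s_j + p_j) ≤ mεT.
-- Append them after a schedule of I₁ that ends by T'. A job with s_j + p_j > εT gets a
-- machine of its own, starting at T'. The others are packed McNaughton-style into the windows
-- [T' + δT, T' + δT + εT] of the following machines; a job cut at the end of a window resumes
-- on the next machine with its setup placed just before that window, which fits since s_j < δT.
-- The number of machines used is bounded by the total removed load divided by εT, hence by m.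
module Submission where

open import Defs
open import Data.Nat using (ℕ)
open import Data.Product using (_×_; ∃-syntax)
open import Data.Integer using (+_)
open import Data.Rational using (ℚ; 0ℚ; 1ℚ; _+_; _*_; _≤_; _<_; _/_)
open import Relation.Binary.PropositionalEquality using (_≡_)

open import Data.Nat as ℕ using (zero; suc) renaming (_≤_ to _≤ₙ_; _<_ to _<ₙ_)
import Data.Nat.Properties as ℕP
import Data.Nat.Coprimality as Coprimality
import Data.Integer as ℤ
import Data.Integer.Properties as ℤP
open import Data.Fin using (Fin; toℕ; fromℕ<) renaming (zero to fzero; suc to fsuc)
import Data.Fin.Properties as FinP
open import Data.Fin.Properties using () renaming (_≟_ to _≟ᶠ_)
open import Data.List using (List; []; _∷_; [_]; _++_; length; lookup; filter; map; mapMaybe; allFin)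
import Data.List.Properties as ListP
open import Data.List.Relation.Unary.All as All using (All; []; _∷_)
import Data.List.Relation.Unary.All.Properties as AllP
open import Data.List.Relation.Unary.AllPairs as AllPairs using (AllPairs; []; _∷_)
import Data.List.Relation.Unary.AllPairs.Properties as AllPairsP
open import Data.List.Relation.Unary.Unique.Propositional using (Unique)
import Data.List.Relation.Unary.Unique.Propositional.Properties as UniqueP
open import Data.List.Membership.Propositional using (_∈_; _∉_)
open import Data.List.Membership.Propositional.Properties using (∈-lookup; ∈-allFin; ∈-filter⁺; ∈-filter⁻; ∈-++⁺ˡ; ∈-++⁺ʳ; ∈-++⁻)
open import Data.List.Relation.Unary.Any using (here)
open import Data.Maybe using (Maybe; just; nothing)
open import Data.Product using (∃; _,_; proj₁; proj₂)
open import Data.Sum using (_⊎_; inj₁; inj₂)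
open import Data.Empty using (⊥-elim)
open import Data.Unit using (tt)
open import Function using (_∘_; id)
open import Relation.Nullary using (¬_; Dec; yes; no)
open import Relation.Nullary.Decidable using (¬?; _×-dec_; toWitness; decidable-stable)
open import Relation.Unary using (Decidable)
open import Relation.Binary using (Symmetric)
open import Relation.Binary.PropositionalEquality using (refl; sym; trans; cong; cong₂; subst; subst₂; _≢_)
open import Data.Rational using (_-_; -_; _÷_; positive; nonNegative)
import Data.Rational.Properties as ℚP
open import Data.Rational.Properties using (_≤?_; _<?_)
open import Data.Rational.Solver using (module +-*-Solver)
open +-*-Solver using (solve; _:+_; _:-_; _:*_; _:=_)

module _ {A : Set} where

  All-tabulateᶠ : {P : A → Set} (xs : List A) → (∀ i → P (lookup xs i)) → All P xs
  All-tabulateᶠ {P} xs h = subst (All P) (ListP.tabulate-lookup xs) (AllP.tabulate⁺ h)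

  AllPairs-tabulateᶠ : {R : A → A → Set} (xs : List A) →
                       (∀ a b → a ≢ b → R (lookup xs a) (lookup xs b)) → AllPairs R xs
  AllPairs-tabulateᶠ {R} xs h =
    subst (AllPairs R) (ListP.tabulate-lookup xs) (AllPairsP.tabulate⁺ (λ {a} {b} → h a b))

  AllPairs-lookupᶠ : {R : A → A → Set} → Symmetric R → ∀ xs → AllPairs R xs →
                     ∀ a b → a ≢ b → R (lookup xs a) (lookup xs b)
  AllPairs-lookupᶠ R-sym (x ∷ xs) (rx ∷ rxs) fzero    fzero    a≢b = ⊥-elim (a≢b refl)
  AllPairs-lookupᶠ R-sym (x ∷ xs) (rx ∷ rxs) fzero    (fsuc b) a≢b = All.lookup rx (∈-lookup b)
  AllPairs-lookupᶠ R-sym (x ∷ xs) (rx ∷ rxs) (fsuc a) fzero    a≢b = R-sym (All.lookup rx (∈-lookup a))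
  AllPairs-lookupᶠ R-sym (x ∷ xs) (rx ∷ rxs) (fsuc a) (fsuc b) a≢b =
    AllPairs-lookupᶠ R-sym xs rxs a b (a≢b ∘ cong fsuc)

  All-cross : {B : Set} {P : A → Set} {Q : B → Set} {R : A → B → Set} {xs : List A} {ys : List B} →
              (∀ {x y} → P x → Q y → R x y) → All P xs → All Q ys → All (λ x → All (R x) ys) xs
  All-cross f pxs qys = All.map (λ px → All.map (f px) qys) pxs

  module _ {B : Set} (f : A → Maybe B) where

    mapMaybe-All : {P : A → Set} {Q : B → Set} → (∀ {x y} → f x ≡ just y → P x → Q y) →
                   ∀ {xs} → All P xs → All Q (mapMaybe f xs)
    mapMaybe-All h {[]}     []         = []
    mapMaybe-All h {x ∷ xs} (px ∷ pxs) with f x in eq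
    ... | nothing = mapMaybe-All h pxs
    ... | just y  = h eq px ∷ mapMaybe-All h pxs

    mapMaybe-AllPairs : {R : A → A → Set} {S : B → B → Set} →
                        (∀ {x x' y y'} → f x ≡ just y → f x' ≡ just y' → R x x' → S y y') →
                        ∀ {xs} → AllPairs R xs → AllPairs S (mapMaybe f xs)
    mapMaybe-AllPairs h {[]}     []         = []
    mapMaybe-AllPairs h {x ∷ xs} (rx ∷ rxs) with f x in eq
    ... | nothing = mapMaybe-AllPairs h rxs
    ... | just y  = mapMaybe-All (λ eq' → h eq eq') rx ∷ mapMaybe-AllPairs h rxs

map-filter : ∀ {A B : Set} (f : A → B) {P : B → Set} (P? : Decidable P) (xs : List A) →
             map f (filter (P? ∘ f) xs) ≡ filter P? (map f xs)
map-filter f P? []       = refl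
map-filter f P? (x ∷ xs) with P? (f x)
... | yes _ = cong (f x ∷_) (map-filter f P? xs)
... | no _  = map-filter f P? xs

filter-indices : ∀ {A : Set} {P : A → Set} (P? : Decidable P) (xs : List A) →
                 map (lookup xs) (filter (P? ∘ lookup xs) (allFin (length xs))) ≡ filter P? xs
filter-indices P? xs = trans (map-filter (lookup xs) P? (allFin (length xs)))
  (cong (filter P?) (trans (ListP.map-tabulate id (lookup xs)) (ListP.tabulate-lookup xs)))

toList-proj₁ : ∀ {A : Set} {P : A → Set} {xs} (pxs : All P xs) → map proj₁ (All.toList pxs) ≡ xs
toList-proj₁ []         = refl
toList-proj₁ (px ∷ pxs) = cong (_ ∷_) (toList-proj₁ pxs)

module FilterIndex {A : Set} {P : A → Set} (P? : Decidable P) where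

  embed : (xs : List A) → Fin (length (filter P? xs)) → Fin (length xs)
  embed (x ∷ xs) k with P? x
  embed (x ∷ xs) fzero    | yes _ = fzero
  embed (x ∷ xs) (fsuc k) | yes _ = fsuc (embed xs k)
  embed (x ∷ xs) k        | no _  = fsuc (embed xs k)

  lookup-embed : (xs : List A) (k : Fin (length (filter P? xs))) →
                 lookup (filter P? xs) k ≡ lookup xs (embed xs k)
  lookup-embed (x ∷ xs) k with P? x
  lookup-embed (x ∷ xs) fzero    | yes _ = refl
  lookup-embed (x ∷ xs) (fsuc k) | yes _ = lookup-embed xs k
  lookup-embed (x ∷ xs) k        | no _  = lookup-embed xs k

  embed-injective : (xs : List A) {k k' : Fin (length (filter P? xs))} → embed xs k ≡ embed xs k' → k ≡ k'
  embed-injective (x ∷ xs) {k} {k'} eq with P? x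
  embed-injective (x ∷ xs) {fzero}  {fzero}   eq | yes _ = refl
  embed-injective (x ∷ xs) {fsuc k} {fsuc k'} eq | yes _ = cong fsuc (embed-injective xs (FinP.suc-injective eq))
  embed-injective (x ∷ xs) {k}      {k'}      eq | no _  = embed-injective xs (FinP.suc-injective eq)

  embed-satisfies : (xs : List A) (k : Fin (length (filter P? xs))) → P (lookup xs (embed xs k))
  embed-satisfies (x ∷ xs) k with P? x
  embed-satisfies (x ∷ xs) fzero    | yes px = px
  embed-satisfies (x ∷ xs) (fsuc k) | yes _  = embed-satisfies xs k
  embed-satisfies (x ∷ xs) k        | no _   = embed-satisfies xs k

  embed-or-rejected : (xs : List A) (i : Fin (length xs)) → (∃ λ k → embed xs k ≡ i) ⊎ ¬ P (lookup xs i)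
  embed-or-rejected (x ∷ xs) fzero with P? x
  ... | yes _  = inj₁ (fzero , refl)
  ... | no ¬px = inj₂ ¬px
  embed-or-rejected (x ∷ xs) (fsuc i) with P? x | embed-or-rejected xs i
  ... | yes _ | inj₁ (k , eq) = inj₁ (fsuc k , cong fsuc eq)
  ... | no _  | inj₁ (k , eq) = inj₁ (k , cong fsuc eq)
  ... | _     | inj₂ ¬p       = inj₂ ¬p

open ℚP.≤-Reasoning hiding (start)

≤-from-gap : ∀ {x y} c → x + c ≡ y → 0ℚ ≤ c → x ≤ y
≤-from-gap {x} {y} c eq 0≤c = begin
  x       ≡⟨ sym (ℚP.+-identityʳ x) ⟩
  x + 0ℚ  ≤⟨ ℚP.+-monoʳ-≤ x 0≤c ⟩
  x + c   ≡⟨ eq ⟩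
  y       ∎

<-from-gap : ∀ {x y} c → x + c ≡ y → 0ℚ < c → x < y
<-from-gap {x} {y} c eq 0<c = begin-strict
  x       ≡⟨ sym (ℚP.+-identityʳ x) ⟩
  x + 0ℚ  <⟨ ℚP.+-monoʳ-< x 0<c ⟩
  x + c   ≡⟨ eq ⟩
  y       ∎

x+[y-x]≡y : ∀ x y → x + (y - x) ≡ y
x+[y-x]≡y = solve 2 (λ x y → x :+ (y :- x) := y) refl

0≤y-x : ∀ {x y} → x ≤ y → 0ℚ ≤ y - x
0≤y-x {x} {y} x≤y = begin
  0ℚ     ≡⟨ sym (ℚP.+-inverseʳ x) ⟩
  x - x  ≤⟨ ℚP.+-monoˡ-≤ (- x) x≤y ⟩
  y - x  ∎

0<y-x : ∀ {x y} → x < y → 0ℚ < y - x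
0<y-x {x} {y} x<y = begin-strict
  0ℚ     ≡⟨ sym (ℚP.+-inverseʳ x) ⟩
  x - x  <⟨ ℚP.+-monoˡ-< (- x) x<y ⟩
  y - x  ∎

0<1 : 0ℚ < 1ℚ
0<1 = toWitness {a? = 0ℚ <? 1ℚ} tt

0<x*y : ∀ {x y} → 0ℚ < x → 0ℚ < y → 0ℚ < x * y
0<x*y {x} {y} 0<x 0<y = subst (_< x * y) (ℚP.*-zeroˡ y) (ℚP.*-monoˡ-<-pos y {{positive 0<y}} 0<x)

0<x^k : ∀ {x} → 0ℚ < x → ∀ k → 0ℚ < x ^ k
0<x^k 0<x zero    = 0<1
0<x^k 0<x (suc k) = 0<x*y 0<x (0<x^k 0<x k)

ι : ℕ → ℚ
ι n = + n / 1

ι-suc : ∀ n → ι (suc n) ≡ ι n + 1ℚ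
ι-suc n rewrite ℚP.normalize-coprime (Coprimality.sym (Coprimality.1-coprimeTo n)) =
  sym (ℚP./-cong {p₁ = + n ℤ.* + 1 ℤ.+ + 1 ℤ.* + 1} numerator refl)
  where
  numerator : + n ℤ.* + 1 ℤ.+ + 1 ℤ.* + 1 ≡ + suc n
  numerator = trans (cong (ℤ._+ + 1) (ℤP.*-identityʳ (+ n))) (cong +_ (ℕP.+-comm n 1))

ι-mono-< : ∀ {n m} → n <ₙ m → ι n < ι m
ι-mono-< {n} {suc m} (ℕ.s≤s n≤m) with ℕP.m≤n⇒m<n∨m≡n n≤m
... | inj₁ n<m = ℚP.<-trans (ι-mono-< n<m) ιm<ι1+m
  where ιm<ι1+m = <-from-gap 1ℚ (sym (ι-suc m)) 0<1
... | inj₂ refl = <-from-gap 1ℚ (sym (ι-suc m)) 0<1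

ι-mono-≤ : ∀ {n m} → n ≤ₙ m → ι n ≤ ι m
ι-mono-≤ n≤m with ℕP.m≤n⇒m<n∨m≡n n≤m
... | inj₁ n<m  = ℚP.<⇒≤ (ι-mono-< n<m)
... | inj₂ refl = ℚP.≤-refl

ι-cancel-< : ∀ {n m} → ι n < ι m → n <ₙ m
ι-cancel-< {n} {m} ιn<ιm with n ℕ.<? m
... | yes n<m = n<m
... | no n≮m  = ⊥-elim (ℚP.<-irrefl refl (ℚP.<-≤-trans ιn<ιm (ι-mono-≤ (ℕP.≮⇒≥ n≮m))))

ι-suc-*ʳ : ∀ n x → ι (suc n) * x ≡ ι n * x + x
ι-suc-*ʳ n x = trans (cong (_* x) (ι-suc n))
  (trans (ℚP.*-distribʳ-+ x (ι n) 1ℚ) (cong (λ y → ι n * x + y) (ℚP.*-identityˡ x)))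

sumℚ-++ : ∀ xs ys → sumℚ (xs ++ ys) ≡ sumℚ xs + sumℚ ys
sumℚ-++ []       ys = sym (ℚP.+-identityˡ _)
sumℚ-++ (x ∷ xs) ys = trans (cong (λ y → x + y) (sumℚ-++ xs ys)) (sym (ℚP.+-assoc x _ _))

sumℚ-nonNeg : ∀ {A : Set} (f : A → ℚ) {xs} → All (λ x → 0ℚ ≤ f x) xs → 0ℚ ≤ sumℚ (map f xs)
sumℚ-nonNeg f []           = ℚP.≤-refl
sumℚ-nonNeg f (0≤fx ∷ 0≤s) = ℚP.+-mono-≤ 0≤fx (sumℚ-nonNeg f 0≤s)

sumℚ-≥-count : ∀ {A : Set} (f : A → ℚ) c {xs} → All (λ x → c < f x) xs → ι (length xs) * c ≤ sumℚ (map f xs)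
sumℚ-≥-count f c []                      = ℚP.≤-reflexive (ℚP.*-zeroˡ c)
sumℚ-≥-count f c {x ∷ xs} (c<fx ∷ c<fxs) = begin
  ι (suc (length xs)) * c      ≡⟨ trans (ι-suc-*ʳ (length xs) c) (ℚP.+-comm _ c) ⟩
  c + ι (length xs) * c        ≤⟨ ℚP.+-mono-≤ (ℚP.<⇒≤ c<fx) (sumℚ-≥-count f c c<fxs) ⟩
  f x + sumℚ (map f xs)        ∎

sumℚ-filter-disjoint : ∀ {A : Set} {P Q M : A → Set} (P? : Decidable P) (Q? : Decidable Q) (M? : Decidable M)
  (f : A → ℚ) → (∀ {x} → P x → ¬ Q x) → (∀ {x} → P x → M x) → (∀ {x} → Q x → M x) → (∀ x → 0ℚ ≤ f x) →
  ∀ xs → sumℚ (map f (filter P? xs)) + sumℚ (map f (filter Q? xs)) ≤ sumℚ (map f (filter M? xs))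
sumℚ-filter-disjoint P? Q? M? f P⇒¬Q P⇒M Q⇒M 0≤f [] = ℚP.≤-reflexive (ℚP.+-identityʳ 0ℚ)
sumℚ-filter-disjoint P? Q? M? f P⇒¬Q P⇒M Q⇒M 0≤f (x ∷ xs) with P? x | Q? x | M? x
... | yes px | yes qx | _      = ⊥-elim (P⇒¬Q px qx)
... | yes px | no _   | no ¬mx = ⊥-elim (¬mx (P⇒M px))
... | no _   | yes qx | no ¬mx = ⊥-elim (¬mx (Q⇒M qx))
... | yes _  | no _   | yes _  = ℚP.≤-trans (ℚP.≤-reflexive (ℚP.+-assoc (f x) _ _)) (ℚP.+-monoʳ-≤ (f x) ih)
  where ih = sumℚ-filter-disjoint P? Q? M? f P⇒¬Q P⇒M Q⇒M 0≤f xs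
... | no _   | yes _  | yes _  = ℚP.≤-trans (ℚP.≤-reflexive (solve 3 (λ a b c → b :+ (a :+ c) := a :+ (b :+ c)) refl (f x) sP sQ))
                                           (ℚP.+-monoʳ-≤ (f x) ih)
  where
  sP = sumℚ (map f (filter P? xs))
  sQ = sumℚ (map f (filter Q? xs))
  ih = sumℚ-filter-disjoint P? Q? M? f P⇒¬Q P⇒M Q⇒M 0≤f xs
... | no _   | no _   | yes _  = ℚP.≤-trans ih (≤-from-gap (f x) (ℚP.+-comm _ (f x)) (0≤f x))
  where ih = sumℚ-filter-disjoint P? Q? M? f P⇒¬Q P⇒M Q⇒M 0≤f xs
... | no _   | no _   | no _   = sumℚ-filter-disjoint P? Q? M? f P⇒¬Q P⇒M Q⇒M 0≤f xs

module Shares {X : Set} {n : ℕ} (jobOf : X → Fin n) (fracOf : X → ℚ) where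

  share : Fin n → List X → ℚ
  share j xs = sumℚ (map fracOf (filter (λ x → jobOf x ≟ᶠ j) xs))

  share-++ : ∀ j xs ys → share j (xs ++ ys) ≡ share j xs + share j ys
  share-++ j xs ys = begin-equality
    sumℚ (map fracOf (filter J? (xs ++ ys)))                     ≡⟨ cong (sumℚ ∘ map fracOf) (ListP.filter-++ J? xs ys) ⟩
    sumℚ (map fracOf (filter J? xs ++ filter J? ys))             ≡⟨ cong sumℚ (ListP.map-++ fracOf (filter J? xs) _) ⟩
    sumℚ (map fracOf (filter J? xs) ++ map fracOf (filter J? ys)) ≡⟨ sumℚ-++ (map fracOf (filter J? xs)) _ ⟩
    share j xs + share j ys                                      ∎
    where J? = λ x → jobOf x ≟ᶠ j

  share-none : ∀ j {xs} → All (λ x → jobOf x ≢ j) xs → share j xs ≡ 0ℚ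
  share-none j []                     = refl
  share-none j {x ∷ xs} (x≢j ∷ xs≢j) with jobOf x ≟ᶠ j
  ... | yes x≡j = ⊥-elim (x≢j x≡j)
  ... | no _    = share-none j xs≢j

  share-all : ∀ j {xs} → All (λ x → jobOf x ≡ j) xs → share j xs ≡ sumℚ (map fracOf xs)
  share-all j []                     = refl
  share-all j {x ∷ xs} (x≡j ∷ xs≡j) with jobOf x ≟ᶠ j
  ... | yes _   = cong (λ s → fracOf x + s) (share-all j xs≡j)
  ... | no x≢j  = ⊥-elim (x≢j x≡j)

  record Covers (R : List (Fin n)) (xs : List X) : Set where
    field
      jobs∈   : All (λ x → jobOf x ∈ R) xs
      share≡1 : ∀ {j} → j ∈ R → share j xs ≡ 1ℚ
  open Covers public

  share-uncovered : ∀ {R xs j} → Covers R xs → j ∉ R → share j xs ≡ 0ℚ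
  share-uncovered {j = j} cov j∉R = share-none j (All.map (λ x∈R x≡j → j∉R (subst (_∈ _) x≡j x∈R)) (jobs∈ cov))

  covers-single : ∀ {j xs} → All (λ x → jobOf x ≡ j) xs → sumℚ (map fracOf xs) ≡ 1ℚ → Covers [ j ] xs
  covers-single {j} xs≡j sum≡1 = record
    { jobs∈   = All.map (λ x≡j → here x≡j) xs≡j
    ; share≡1 = λ { (here refl) → trans (share-all j xs≡j) sum≡1 }
    }

  covers-++ : ∀ {R R' xs ys} → (∀ {j} → j ∈ R → j ∉ R') → Covers R xs → Covers R' ys → Covers (R ++ R') (xs ++ ys)
  covers-++ {R} {R'} {xs} {ys} apart cov cov' = record
    { jobs∈   = AllP.++⁺ (All.map ∈-++⁺ˡ (jobs∈ cov)) (All.map (∈-++⁺ʳ R) (jobs∈ cov'))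
    ; share≡1 = one
    }
    where
    one : ∀ {j} → j ∈ R ++ R' → share j (xs ++ ys) ≡ 1ℚ
    one {j} j∈ with ∈-++⁻ R j∈
    ... | inj₁ j∈R  = trans (share-++ j xs ys)
        (trans (cong₂ _+_ (share≡1 cov j∈R) (share-uncovered cov' (apart j∈R))) (ℚP.+-identityʳ 1ℚ))
    ... | inj₂ j∈R' = trans (share-++ j xs ys)
        (trans (cong₂ _+_ (share-uncovered cov (λ j∈R → apart j∈R j∈R')) (share≡1 cov' j∈R')) (ℚP.+-identityˡ 1ℚ))

module _ {X Y : Set} {n n' : ℕ} (jx : X → Fin n) (fx : X → ℚ) (jy : Y → Fin n') (fy : Y → ℚ) where
  open Shares jx fx renaming (share to shareˣ)
  open Shares jy fy renaming (share to shareʸ)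

  share-map : (f : X → Y) (g : Fin n → Fin n') → (∀ {a b} → g a ≡ g b → a ≡ b) →
              (∀ x → jy (f x) ≡ g (jx x)) → (∀ x → fy (f x) ≡ fx x) →
              ∀ j xs → shareʸ (g j) (map f xs) ≡ shareˣ j xs
  share-map f g g-inj f-job f-frac j []       = refl
  share-map f g g-inj f-job f-frac j (x ∷ xs) with jy (f x) ≟ᶠ g j | jx x ≟ᶠ j
  ... | yes _  | yes _  = cong₂ _+_ (f-frac x) (share-map f g g-inj f-job f-frac j xs)
  ... | yes eq | no ne  = ⊥-elim (ne (g-inj (trans (sym (f-job x)) eq)))
  ... | no ne  | yes eq = ⊥-elim (ne (trans (f-job x) (cong g eq)))
  ... | no _   | no _   = share-map f g g-inj f-job f-frac j xs

module _ {X Y : Set} {n n' : ℕ} (jx : X → Fin n) (fx : X → ℚ) (jy : Y → Fin n') (fy : Y → ℚ) where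
  open Shares jx fx renaming (share to shareˣ)
  open Shares jy fy renaming (share to shareʸ)

  share-mapMaybe : (f : X → Maybe Y) (g : Fin n' → Fin n) → (∀ {a b} → g a ≡ g b → a ≡ b) →
                   (∀ {x y} → f x ≡ just y → g (jy y) ≡ jx x × fy y ≡ fx x) →
                   (∀ {x} → f x ≡ nothing → ∀ k → jx x ≢ g k) →
                   ∀ k xs → shareʸ k (mapMaybe f xs) ≡ shareˣ (g k) xs
  share-mapMaybe f g g-inj f-just f-nothing k []       = refl
  share-mapMaybe f g g-inj f-just f-nothing k (x ∷ xs) with f x in eq
  ... | nothing with jx x ≟ᶠ g k
  ...   | yes x≡k = ⊥-elim (f-nothing eq k x≡k)
  ...   | no _    = share-mapMaybe f g g-inj f-just f-nothing k xs
  share-mapMaybe f g g-inj f-just f-nothing k (x ∷ xs) | just y with f-just eq | jy y ≟ᶠ k | jx x ≟ᶠ g k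
  ... | _ , frac≡ | yes _  | yes _  = cong₂ _+_ frac≡ (share-mapMaybe f g g-inj f-just f-nothing k xs)
  ... | job≡ , _  | yes eq | no ne  = ⊥-elim (ne (trans (sym job≡) (cong g eq)))
  ... | job≡ , _  | no ne  | yes eq = ⊥-elim (ne (g-inj (trans job≡ eq)))
  ... | _         | no _   | no _   = share-mapMaybe f g g-inj f-just f-nothing k xs

module ScheduleLists (I : Instance) where

  open Shares (job {I}) (frac {I}) public

  Admissible : Part I → Set
  Admissible q = (0ℚ < frac q) × (frac q ≤ 1ℚ) × (0ℚ ≤ start q)

  Compatible : Part I → Part I → Set
  Compatible q r = (mach q ≡ mach r → Disjoint q r) × (job q ≡ job r → Disjoint q r)

  Disjoint-sym : ∀ {q r : Part I} → Disjoint q r → Disjoint r q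
  Disjoint-sym (inj₁ h) = inj₂ h
  Disjoint-sym (inj₂ h) = inj₁ h

  Compatible-sym : Symmetric Compatible
  Compatible-sym {q} {r} (same-mach , same-job) =
    (λ eq → Disjoint-sym {q} {r} (same-mach (sym eq))) , (λ eq → Disjoint-sym {q} {r} (same-job (sym eq)))

  IsSchedule⇒lists : ∀ {ps} → IsSchedule I ps → All Admissible ps × AllPairs Compatible ps
  IsSchedule⇒lists {ps} S =
    All-tabulateᶠ ps (λ a → fracPos a , fracLe1 a , startNonneg a) ,
    AllPairs-tabulateᶠ ps (λ a b a≢b → machDisj a b a≢b , jobDisj a b a≢b)
    where open IsSchedule S

  lists⇒IsSchedule : ∀ {ps} → All Admissible ps → AllPairs Compatible ps → (∀ j → share j ps ≡ 1ℚ) → IsSchedule I ps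
  lists⇒IsSchedule {ps} adm compat shares = record
    { fracPos     = λ a → proj₁ (admissible a)
    ; fracLe1     = λ a → proj₁ (proj₂ (admissible a))
    ; startNonneg = λ a → proj₂ (proj₂ (admissible a))
    ; fracSum     = shares
    ; machDisj    = λ a b a≢b → proj₁ (compatible a b a≢b)
    ; jobDisj     = λ a b a≢b → proj₂ (compatible a b a≢b)
    }
    where
    compatible : ∀ a b → a ≢ b → Compatible (lookup ps a) (lookup ps b)
    compatible = AllPairs-lookupᶠ {R = Compatible} (λ {q} {r} → Compatible-sym {q} {r}) ps compat
    admissible : ∀ a → Admissible (lookup ps a)
    admissible a = All.lookup adm (∈-lookup {xs = ps} a)

  within : ∀ {ps : List (Part I)} {T} → All (λ q → endT q ≤ T) ps → ∀ a → endT (lookup ps a) ≤ T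
  within {ps} ends a = All.lookup ends (∈-lookup {xs = ps} a)

module SubInstance (I : Instance) {K : Job → Set} (K? : Decidable K) where

  I₁ : Instance
  I₁ = inst (machines I) (filter K? (jobs I))

  open FilterIndex K?
  open ScheduleLists

  E : JobIdx I₁ → JobIdx I
  E = embed (jobs I)

  E-injective : ∀ {k k'} → E k ≡ E k' → k ≡ k'
  E-injective = embed-injective (jobs I)

  E-kept : ∀ k → K (lookup (jobs I) (E k))
  E-kept = embed-satisfies (jobs I)

  E-or-rejected : ∀ j → (∃ λ k → E k ≡ j) ⊎ ¬ K (lookup (jobs I) j)
  E-or-rejected = embed-or-rejected (jobs I)

  relabel : Part I₁ → Part I
  relabel q = part (E (job q)) (frac q) (mach q) (start q)

  endT-relabel : ∀ q → endT (relabel q) ≡ endT q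
  endT-relabel q = cong (λ x → start q + (setup x + frac q * proc x)) (sym (lookup-embed (jobs I) (job q)))

  Disjoint-relabel : ∀ q r → Disjoint (relabel q) (relabel r) ≡ Disjoint q r
  Disjoint-relabel q r = cong₂ (λ x y → (x ≤ start r) ⊎ (y ≤ start q)) (endT-relabel q) (endT-relabel r)

  Compatible-relabel⁺ : ∀ q r → Compatible I₁ q r → Compatible I (relabel q) (relabel r)
  Compatible-relabel⁺ q r (same-mach , same-job) =
    (λ eq → subst id (sym (Disjoint-relabel q r)) (same-mach eq)) ,
    (λ eq → subst id (sym (Disjoint-relabel q r)) (same-job (E-injective eq)))

  Compatible-relabel⁻ : ∀ q r → Compatible I (relabel q) (relabel r) → Compatible I₁ q r
  Compatible-relabel⁻ q r (same-mach , same-job) =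
    (λ eq → subst id (Disjoint-relabel q r) (same-mach eq)) ,
    (λ eq → subst id (Disjoint-relabel q r) (same-job (cong E eq)))

  share-relabel : ∀ k ps → share I (E k) (map relabel ps) ≡ share I₁ k ps
  share-relabel = share-map (job {I₁}) (frac {I₁}) (job {I}) (frac {I}) relabel E E-injective (λ _ → refl) (λ _ → refl)

  unrelabel : Part I → Maybe (Part I₁)
  unrelabel q with E-or-rejected (job q)
  ... | inj₁ (k , _) = just (part k (frac q) (mach q) (start q))
  ... | inj₂ _       = nothing

  unrelabel-just : ∀ {q y} → unrelabel q ≡ just y → relabel y ≡ q
  unrelabel-just {q} eq with E-or-rejected (job q)
  unrelabel-just {q} refl | inj₁ (k , Ek≡q) = cong (λ j → part j (frac q) (mach q) (start q)) Ek≡q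

  unrelabel-nothing : ∀ {q} → unrelabel q ≡ nothing → ∀ k → job q ≢ E k
  unrelabel-nothing {q} eq k q≡Ek with E-or-rejected (job q)
  unrelabel-nothing {q} () k q≡Ek | inj₁ _
  unrelabel-nothing {q} eq k q≡Ek | inj₂ ¬K =
    ¬K (subst (λ j → K (lookup (jobs I) j)) (sym q≡Ek) (E-kept k))

  restrict : ∀ {T} → HasScheduleWithin I T → HasScheduleWithin I₁ T
  restrict {T} (ps , S , ends) = mapMaybe unrelabel ps , lists⇒IsSchedule I₁ admissible compatible shares , within I₁ ends₁
    where
    adm-compat = IsSchedule⇒lists I S
    admissible : All (Admissible I₁) (mapMaybe unrelabel ps)
    admissible = mapMaybe-All unrelabel (λ eq → subst (Admissible I) (sym (unrelabel-just eq))) (proj₁ adm-compat)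
    compatible : AllPairs (Compatible I₁) (mapMaybe unrelabel ps)
    compatible = mapMaybe-AllPairs unrelabel
      (λ {_} {_} {y} {y'} eq eq' c → Compatible-relabel⁻ y y' (subst₂ (Compatible I) (sym (unrelabel-just eq)) (sym (unrelabel-just eq')) c))
      (proj₂ adm-compat)
    shares : ∀ k → share I₁ k (mapMaybe unrelabel ps) ≡ 1ℚ
    shares k = trans (share-mapMaybe (job {I}) (frac {I}) (job {I₁}) (frac {I₁}) unrelabel E E-injective
                        (λ eq → cong job (unrelabel-just eq) , cong frac (unrelabel-just eq)) unrelabel-nothing k ps)
                     (IsSchedule.fracSum S (E k))
    ends₁ : All (λ y → endT y ≤ T) (mapMaybe unrelabel ps)
    ends₁ = mapMaybe-All unrelabel
      (λ {_} {y} eq h → subst (_≤ T) (endT-relabel y) (subst (λ q → endT q ≤ T) (sym (unrelabel-just eq)) h))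
      (All-tabulateᶠ ps ends)

module Packing (I : Instance) (wf : WellFormed I) (T' e d : ℚ) where

  J : Set
  J = JobIdx I

  load : J → ℚ
  load j = sJ I j + pJ I j

  load-nonNeg : ∀ j → 0ℚ ≤ load j
  load-nonNeg j = ℚP.<⇒≤ (ℚP.+-mono-< (proj₂ (wf j)) (proj₁ (wf j)))

  -- the small jobs are packed into the windows [B , B + e], one machine after another
  B : ℚ
  B = T' + d

  -- machines are unbounded naturals until the final count shows that m of them suffice
  record Piece : Set where
    constructor piece
    field
      pjob   : J
      pfrac  : ℚ
      pmach  : ℕ
      pstart : ℚ
  open Piece public

  pend : Piece → ℚ
  pend q = pstart q + (sJ I (pjob q) + pfrac q * pJ I (pjob q))

  _≼_ : ℕ × ℚ → ℕ × ℚ → Set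
  (i , x) ≼ (k , y) = i <ₙ k ⊎ (i ≡ k × x ≤ y)

  ≼-trans : ∀ {a b c} → a ≼ b → b ≼ c → a ≼ c
  ≼-trans (inj₁ i<k)          (inj₁ k<l)          = inj₁ (ℕP.<-trans i<k k<l)
  ≼-trans (inj₁ i<k)          (inj₂ (refl , _))   = inj₁ i<k
  ≼-trans (inj₂ (refl , _))   (inj₁ k<l)          = inj₁ k<l
  ≼-trans (inj₂ (refl , x≤y)) (inj₂ (refl , y≤z)) = inj₂ (refl , ℚP.≤-trans x≤y y≤z)

  StartsFrom EndsBy : ℕ × ℚ → Piece → Set
  StartsFrom c q = c ≼ (pmach q , pstart q)
  EndsBy c q = (pmach q , pend q) ≼ c

  Separated : Piece → Piece → Set
  Separated q r = (pend q ≤ pstart r) ⊎ (pend r ≤ pstart q)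

  Ordered : Piece → Piece → Set
  Ordered q r = (pmach q , pend q) ≼ (pmach r , pstart r) × (pjob q ≡ pjob r → Separated q r)

  Fits : Piece → Set
  Fits q = (0ℚ < pfrac q) × (pfrac q ≤ 1ℚ) × (T' ≤ pstart q) × (pend q ≤ T' + (e + d))

  open Shares pjob pfrac public

  Ordered-++ : ∀ {c R R' xs ys} → (∀ {j} → j ∈ R → j ∉ R') → Covers R xs → Covers R' ys →
               All (EndsBy c) xs → All (StartsFrom c) ys →
               AllPairs Ordered xs → AllPairs Ordered ys → AllPairs Ordered (xs ++ ys)
  Ordered-++ {c} {R} {R'} apart cov cov' ends starts ordered ordered' =
    AllPairsP.++⁺ ordered ordered'
      (All-cross {R = Ordered} (λ {q} {r} → across {q} {r}) (All.zip (ends , jobs∈ cov)) (All.zip (starts , jobs∈ cov')))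
    where
    across : ∀ {q r} → EndsBy c q × pjob q ∈ R → StartsFrom c r × pjob r ∈ R' → Ordered q r
    across {q} {r} (q≼c , q∈R) (c≼r , r∈R') =
      ≼-trans {_} {c} {pmach r , pstart r} q≼c c≼r , λ same → ⊥-elim (apart q∈R (subst (_∈ R') (sym same) r∈R'))

  B+x≤T'+[e+d] : ∀ {x} → x ≤ e → B + x ≤ T' + (e + d)
  B+x≤T'+[e+d] {x} x≤e =
    ≤-from-gap (e - x) (solve 4 (λ T' d x e → T' :+ d :+ x :+ (e :- x) := T' :+ (e :+ d)) refl T' d x e) (0≤y-x x≤e)

  Big Small : J → Set
  Big j = (sJ I j < d) × (pJ I j < e)
  Small j = (sJ I j < d) × (load j ≤ e)

  stack : ℕ → List J → List Piece
  stack k []      = []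
  stack k (j ∷ R) = piece j 1ℚ k T' ∷ stack (suc k) R

  record Stacked (k : ℕ) (R : List J) (xs : List Piece) : Set where
    field
      covers  : Covers R xs
      ordered : AllPairs Ordered xs
      fits    : All Fits xs
      starts  : All (StartsFrom (k , T')) xs
      below   : All (λ q → pmach q <ₙ k ℕ.+ length R) xs

  stack-spec : ∀ k R → All Big R → Unique R → Stacked k R (stack k R)
  stack-spec k []      []            []              = record { covers = record { jobs∈ = [] ; share≡1 = λ () }
                                                              ; ordered = [] ; fits = [] ; starts = [] ; below = [] }
  stack-spec k (j ∷ R) (big ∷ bigs) (j∉R ∷ unique) = record
    { covers  = covers-++ apart head-covers S.covers
    ; ordered = Ordered-++ apart head-covers S.covers (inj₁ (ℕP.n<1+n k) ∷ []) S.starts ([] ∷ []) S.ordered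
    ; fits    = (0<1 , ℚP.≤-refl , ℚP.≤-refl , fits-end) ∷ S.fits
    ; starts  = inj₂ (refl , ℚP.≤-refl) ∷ All.map (≼-trans (inj₁ (ℕP.n<1+n k))) S.starts
    ; below   = ℕP.m<m+n k ℕ.z<s ∷ All.map (λ {q} h → subst (pmach q <ₙ_) (sym (ℕP.+-suc k (length R))) h) S.below
    }
    where
    module S = Stacked (stack-spec (suc k) R bigs unique)
    apart : ∀ {j'} → j' ∈ [ j ] → j' ∉ R
    apart (here refl) = AllP.All¬⇒¬Any j∉R
    head-covers : Covers [ j ] [ piece j 1ℚ k T' ]
    head-covers = covers-single (refl ∷ []) (ℚP.+-identityʳ 1ℚ)
    fits-end : T' + (sJ I j + 1ℚ * pJ I j) ≤ T' + (e + d)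
    fits-end = ℚP.+-monoʳ-≤ T' (subst (λ x → sJ I j + x ≤ e + d) (sym (ℚP.*-identityˡ (pJ I j)))
                 (ℚP.≤-trans (ℚP.+-mono-≤ (ℚP.<⇒≤ (proj₁ big)) (ℚP.<⇒≤ (proj₂ big))) (ℚP.≤-reflexive (ℚP.+-comm d e))))

  record Placed : Set where
    constructor placed
    field
      chunk : List Piece
      next  : ℕ
      level : ℚ
  open Placed public

  -- the fraction of j that exactly fills the window of the current machine
  splitFrac : ℚ → J → ℚ
  splitFrac L j = _÷_ (e - L - sJ I j) (pJ I j) {{ℚP.pos⇒nonZero (pJ I j) {{positive (proj₁ (wf j))}}}}

  splitFrac-spec : ∀ L j → splitFrac L j * pJ I j ≡ e - L - sJ I j
  splitFrac-spec L j = trans (ℚP.*-assoc (e - L - sJ I j) _ (pJ I j))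
    (trans (cong (λ x → (e - L - sJ I j) * x) (ℚP.*-inverseˡ (pJ I j) {{p≢0}})) (ℚP.*-identityʳ _))
    where p≢0 = ℚP.pos⇒nonZero (pJ I j) {{positive (proj₁ (wf j))}}

  placeWith : ℕ → (L : ℚ) (j : J) → Dec (L + load j ≤ e) → Dec (L + sJ I j < e) → Placed
  placeWith i L j (yes _) _      = placed [ piece j 1ℚ i (B + L) ] i (L + load j)
  placeWith i L j (no _) (yes _) =
    placed (piece j f i (B + L) ∷ piece j (1ℚ - f) (suc i) (B - sJ I j) ∷ []) (suc i) (L + load j - e)
    where f = splitFrac L j
  placeWith i L j (no _) (no _)  = placed [ piece j 1ℚ (suc i) (B + (L - e)) ] (suc i) (L + load j - e)

  place : ℕ → ℚ → J → Placed
  place i L j = placeWith i L j (L + load j ≤? e) (L + sJ I j <? e)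

  pack : ℕ → ℚ → List J → List Piece
  pack i L []      = []
  pack i L (j ∷ R) = chunk (place i L j) ++ pack (next (place i L j)) (level (place i L j)) R

  record PlacementSpec (i : ℕ) (L : ℚ) (j : J) (P : Placed) : Set where
    field
      level-pos : 0ℚ < level P
      level≤e   : level P ≤ e
      advance   : ι (next P) * e + level P ≡ ι i * e + L + load j
      progress  : (i , B + L) ≼ (next P , B + level P)
      covers    : Covers [ j ] (chunk P)
      ordered   : AllPairs Ordered (chunk P)
      fits      : All Fits (chunk P)
      starts    : All (StartsFrom (i , B + L)) (chunk P)
      ends      : All (EndsBy (next P , B + level P)) (chunk P)

  module Placement (i : ℕ) (L : ℚ) (j : J) (small : Small j) (0≤L : 0ℚ ≤ L) (L≤e : L ≤ e) where
    s p v : ℚ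
    s = sJ I j
    p = pJ I j
    v = load j

    T'≤B+L : T' ≤ B + L
    T'≤B+L = ≤-from-gap (d + L) (solve 3 (λ T' d L → T' :+ (d :+ L) := T' :+ d :+ L) refl T' d L)
               (ℚP.+-mono-≤ (ℚP.<⇒≤ (ℚP.<-trans (proj₂ (wf j)) (proj₁ small))) 0≤L)

    one-piece : ∀ k t → Covers [ j ] [ piece j 1ℚ k t ]
    one-piece k t = covers-single (refl ∷ []) (ℚP.+-identityʳ 1ℚ)

    end-of-whole : ∀ k t → pend (piece j 1ℚ k t) ≡ t + v
    end-of-whole k t = cong (λ x → t + (s + x)) (ℚP.*-identityˡ p)

    whole-spec : (fits : L + v ≤ e) → PlacementSpec i L j (placed [ piece j 1ℚ i (B + L) ] i (L + v))
    whole-spec fits = record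
      { level-pos = ℚP.≤-<-trans 0≤L (<-from-gap v refl (ℚP.+-mono-< (proj₂ (wf j)) (proj₁ (wf j))))
      ; level≤e   = fits
      ; advance   = solve 4 (λ x e L v → x :* e :+ (L :+ v) := x :* e :+ L :+ v) refl (ι i) e L v
      ; progress  = inj₂ (refl , ℚP.+-monoʳ-≤ B (≤-from-gap v refl (load-nonNeg j)))
      ; covers    = one-piece i (B + L)
      ; ordered   = [] ∷ []
      ; fits      = (0<1 , ℚP.≤-refl , T'≤B+L , ℚP.≤-trans (ℚP.≤-reflexive end≡) (B+x≤T'+[e+d] fits)) ∷ []
      ; starts    = inj₂ (refl , ℚP.≤-refl) ∷ []
      ; ends      = inj₂ (refl , ℚP.≤-reflexive end≡) ∷ []
      }
      where
      end≡ : pend (piece j 1ℚ i (B + L)) ≡ B + (L + v)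
      end≡ = trans (end-of-whole i (B + L)) (ℚP.+-assoc B L v)

    module Overflow (overflow : e < L + v) where
      L' f : ℚ
      L' = L + v - e
      f = splitFrac L j

      0<L' : 0ℚ < L'
      0<L' = 0<y-x overflow

      L'≤e : L' ≤ e
      L'≤e = ≤-from-gap ((e - L) + (e - v)) (solve 3 (λ L v e → L :+ v :- e :+ ((e :- L) :+ (e :- v)) := e) refl L v e)
               (ℚP.+-mono-≤ (0≤y-x L≤e) (0≤y-x (proj₂ small)))

      advance-suc : ι (suc i) * e + L' ≡ ι i * e + L + v
      advance-suc = trans (cong (_+ L') (ι-suc-*ʳ i e))
        (solve 4 (λ x e L v → x :* e :+ e :+ (L :+ v :- e) := x :* e :+ L :+ v) refl (ι i) e L v)

      split-spec : L + s < e → PlacementSpec i L j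
        (placed (piece j f i (B + L) ∷ piece j (1ℚ - f) (suc i) (B - s) ∷ []) (suc i) L')
      split-spec setup-fits = record
        { level-pos = 0<L'
        ; level≤e   = L'≤e
        ; advance   = advance-suc
        ; progress  = inj₁ (ℕP.n<1+n i)
        ; covers    = covers-single (refl ∷ refl ∷ [])
                        (trans (cong (λ x → f + x) (ℚP.+-identityʳ (1ℚ - f))) (solve 2 (λ f o → f :+ (o :- f) := o) refl f 1ℚ))
        ; ordered   = ((inj₁ (ℕP.n<1+n i) , λ _ → inj₂ second-before-first) ∷ []) ∷ [] ∷ []
        ; fits      = (0<f , ℚP.<⇒≤ f<1 , T'≤B+L , ℚP.≤-trans (ℚP.≤-reflexive end₁) (B+x≤T'+[e+d] ℚP.≤-refl))
                    ∷ (0<y-x f<1 , ≤-from-gap f (solve 2 (λ o f → o :- f :+ f := o) refl 1ℚ f) (ℚP.<⇒≤ 0<f) , T'≤B-s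
                      , ℚP.≤-trans (ℚP.≤-reflexive end₂) (B+x≤T'+[e+d] L'≤e)) ∷ []
        ; starts    = inj₂ (refl , ℚP.≤-refl) ∷ inj₁ (ℕP.n<1+n i) ∷ []
        ; ends      = inj₁ (ℕP.n<1+n i) ∷ inj₂ (refl , ℚP.≤-reflexive end₂) ∷ []
        }
        where
        fp≡ : f * p ≡ e - L - s
        fp≡ = splitFrac-spec L j
        0<f : 0ℚ < f
        0<f = ℚP.*-cancelʳ-<-nonNeg p {{nonNegative (ℚP.<⇒≤ (proj₁ (wf j)))}}
                (subst₂ _<_ (sym (ℚP.*-zeroˡ p)) (sym fp≡)
                  (subst (0ℚ <_) (solve 3 (λ e L s → e :- (L :+ s) := e :- L :- s) refl e L s) (0<y-x setup-fits)))
        f<1 : f < 1ℚ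
        f<1 = ℚP.*-cancelʳ-<-nonNeg p {{nonNegative (ℚP.<⇒≤ (proj₁ (wf j)))}}
                (subst₂ _<_ (sym fp≡) (sym (ℚP.*-identityˡ p))
                  (<-from-gap L' (solve 4 (λ e L s p → e :- L :- s :+ (L :+ (s :+ p) :- e) := p) refl e L s p) 0<L'))
        end₁ : pend (piece j f i (B + L)) ≡ B + e
        end₁ = trans (cong (λ x → B + L + (s + x)) fp≡)
                 (solve 4 (λ B L s e → B :+ L :+ (s :+ (e :- L :- s)) := B :+ e) refl B L s e)
        end₂ : pend (piece j (1ℚ - f) (suc i) (B - s)) ≡ B + L'
        end₂ = trans (cong (λ x → B - s + (s + x))
                       (trans (solve 3 (λ o f p → (o :- f) :* p := o :* p :- f :* p) refl 1ℚ f p)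
                              (cong₂ _-_ (ℚP.*-identityˡ p) fp≡)))
                 (solve 5 (λ B L s p e → B :- s :+ (s :+ (p :- (e :- L :- s))) := B :+ (L :+ (s :+ p) :- e)) refl B L s p e)
        T'≤B-s : T' ≤ B - s
        T'≤B-s = ≤-from-gap (d - s) (solve 3 (λ T' d s → T' :+ (d :- s) := T' :+ d :- s) refl T' d s) (ℚP.<⇒≤ (0<y-x (proj₁ small)))
        second-before-first : pend (piece j (1ℚ - f) (suc i) (B - s)) ≤ B + L
        second-before-first = ℚP.≤-trans (ℚP.≤-reflexive end₂)
          (≤-from-gap (e - v) (solve 4 (λ B L v e → B :+ (L :+ v :- e) :+ (e :- v) := B :+ L) refl B L v e) (0≤y-x (proj₂ small)))

      deferred-spec : e ≤ L + s → PlacementSpec i L j (placed [ piece j 1ℚ (suc i) (B + (L - e)) ] (suc i) L')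
      deferred-spec setup-overflows = record
        { level-pos = 0<L'
        ; level≤e   = L'≤e
        ; advance   = advance-suc
        ; progress  = inj₁ (ℕP.n<1+n i)
        ; covers    = one-piece (suc i) (B + (L - e))
        ; ordered   = [] ∷ []
        ; fits      = (0<1 , ℚP.≤-refl , T'≤start , ℚP.≤-trans (ℚP.≤-reflexive end≡) (B+x≤T'+[e+d] L'≤e)) ∷ []
        ; starts    = inj₁ (ℕP.n<1+n i) ∷ []
        ; ends      = inj₂ (refl , ℚP.≤-reflexive end≡) ∷ []
        }
        where
        end≡ : pend (piece j 1ℚ (suc i) (B + (L - e))) ≡ B + L'
        end≡ = trans (end-of-whole (suc i) (B + (L - e))) (solve 4 (λ B L e v → B :+ (L :- e) :+ v := B :+ (L :+ v :- e)) refl B L e v)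
        T'≤start : T' ≤ B + (L - e)
        T'≤start = ≤-from-gap ((d - s) + (L + s - e))
          (solve 5 (λ T' d s L e → T' :+ ((d :- s) :+ (L :+ s :- e)) := T' :+ d :+ (L :- e)) refl T' d s L e)
          (ℚP.+-mono-≤ (ℚP.<⇒≤ (0<y-x (proj₁ small))) (0≤y-x setup-overflows))

    placeWith-spec : ∀ d₁ d₂ → PlacementSpec i L j (placeWith i L j d₁ d₂)
    placeWith-spec (yes fits)     _                     = whole-spec fits
    placeWith-spec (no ¬fits)     (yes setup-fits)      = Overflow.split-spec (ℚP.≰⇒> ¬fits) setup-fits
    placeWith-spec (no ¬fits)     (no setup-overflows)  = Overflow.deferred-spec (ℚP.≰⇒> ¬fits) (ℚP.≮⇒≥ setup-overflows)

  place-spec : ∀ i L j → Small j → 0ℚ ≤ L → L ≤ e → PlacementSpec i L j (place i L j)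
  place-spec i L j small 0≤L L≤e = Placement.placeWith-spec i L j small 0≤L L≤e _ _

  ≼⇒≤ : ∀ {i k x y} → (i , x) ≼ (k , y) → i ≤ₙ k
  ≼⇒≤ (inj₁ i<k)        = ℕP.<⇒≤ i<k
  ≼⇒≤ (inj₂ (refl , _)) = ℕP.≤-refl

  record Packed (i : ℕ) (L : ℚ) (R : List J) (xs : List Piece) : Set where
    field
      covers  : Covers R xs
      ordered : AllPairs Ordered xs
      fits    : All Fits xs
      starts  : All (StartsFrom (i , B + L)) xs
      below   : All (λ q → ι (pmach q) * e < ι i * e + L + sumℚ (map load R)) xs

  pack-spec : 0ℚ ≤ e → ∀ i L R → All Small R → Unique R → 0ℚ ≤ L → L ≤ e → Packed i L R (pack i L R)
  pack-spec 0≤e i L []      []               []              _   _   = record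
    { covers = record { jobs∈ = [] ; share≡1 = λ () } ; ordered = [] ; fits = [] ; starts = [] ; below = [] }
  pack-spec 0≤e i L (j ∷ R) (small ∷ smalls) (j∉R ∷ unique) 0≤L L≤e = record
    { covers  = covers-++ apart S.covers P.covers
    ; ordered = Ordered-++ apart S.covers P.covers S.ends P.starts S.ordered P.ordered
    ; fits    = AllP.++⁺ S.fits P.fits
    ; starts  = AllP.++⁺ S.starts (All.map (≼-trans S.progress) P.starts)
    ; below   = AllP.++⁺ (All.map (λ {q} → chunk-below {q}) S.ends) (All.map (λ h → ℚP.<-≤-trans h (ℚP.≤-reflexive tail≡)) P.below)
    }
    where
    module S = PlacementSpec (place-spec i L j small 0≤L L≤e)
    i' = next (place i L j)
    L' = level (place i L j)
    module P = Packed (pack-spec 0≤e i' L' R smalls unique (ℚP.<⇒≤ S.level-pos) S.level≤e)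
    rest = sumℚ (map load R)
    apart : ∀ {j'} → j' ∈ [ j ] → j' ∉ R
    apart (here refl) = AllP.All¬⇒¬Any j∉R
    chunk-below : ∀ {q} → EndsBy (i' , B + L') q → ι (pmach q) * e < ι i * e + L + (load j + rest)
    chunk-below {q} q≼ = begin-strict
      ι (pmach q) * e          ≤⟨ ℚP.*-monoʳ-≤-nonNeg e {{nonNegative 0≤e}} (ι-mono-≤ (≼⇒≤ q≼)) ⟩
      ι i' * e                 <⟨ <-from-gap L' refl S.level-pos ⟩
      ι i' * e + L'            ≡⟨ S.advance ⟩
      ι i * e + L + load j     ≤⟨ ≤-from-gap rest (ℚP.+-assoc (ι i * e + L) (load j) rest) (sumℚ-nonNeg load (All.universal load-nonNeg R)) ⟩
      ι i * e + L + (load j + rest) ∎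
    tail≡ : ι i' * e + L' + rest ≡ ι i * e + L + (load j + rest)
    tail≡ = trans (cong (_+ rest) S.advance) (ℚP.+-assoc (ι i * e + L) (load j) rest)

module Extension (I : Instance) (wf : WellFormed I) (ε T δ : ℚ) (0<ε : 0ℚ < ε) (0<T : 0ℚ < T) (0<δ : 0ℚ < δ) where

  μ e d : ℚ
  μ = (ε * ε) * δ
  e = ε * T
  d = δ * T

  0<e : 0ℚ < e
  0<e = 0<x*y 0<ε 0<T

  Removed : Job → Set
  Removed x = (μ * T ≤ setup x) × (setup x < d) × (proc x < e)

  open SubInstance I (λ x → ¬? (removed? ε μ δ T x)) public

  js = jobs I
  m = machines I

  module Parts = ScheduleLists I

  module Extend (T' : ℚ) (0<T' : 0ℚ < T') where
    open Packing I wf T' e d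

    BigRemoved? : Decidable (λ j → Removed (lookup js j) × (e < load j))
    BigRemoved? j = removed? ε μ δ T (lookup js j) ×-dec (e <? load j)

    SmallRemoved? : Decidable (λ j → Removed (lookup js j) × (load j ≤ e))
    SmallRemoved? j = removed? ε μ δ T (lookup js j) ×-dec (load j ≤? e)

    bigs smalls : List J
    bigs   = filter BigRemoved? (allFin (length js))
    smalls = filter SmallRemoved? (allFin (length js))

    b : ℕ
    b = length bigs

    pieces : List Piece
    pieces = stack 0 bigs ++ pack b 0ℚ smalls

    big : ∀ {j} → j ∈ bigs → Removed (lookup js j) × (e < load j)
    big j∈ = proj₂ (∈-filter⁻ BigRemoved? {xs = allFin (length js)} j∈)

    small : ∀ {j} → j ∈ smalls → Removed (lookup js j) × (load j ≤ e)
    small j∈ = proj₂ (∈-filter⁻ SmallRemoved? {xs = allFin (length js)} j∈)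

    bigs-apart : ∀ {j} → j ∈ bigs → j ∉ smalls
    bigs-apart j∈bigs j∈smalls = ℚP.<-irrefl refl (ℚP.<-≤-trans (proj₂ (big j∈bigs)) (proj₂ (small j∈smalls)))

    bigs-big : All Big bigs
    bigs-big = All.tabulate (λ j∈ → proj₁ (proj₂ (proj₁ (big j∈))) , proj₂ (proj₂ (proj₁ (big j∈))))

    smalls-small : All Small smalls
    smalls-small = All.tabulate (λ j∈ → proj₁ (proj₂ (proj₁ (small j∈))) , proj₂ (small j∈))

    module St = Stacked (stack-spec 0 bigs bigs-big (UniqueP.filter⁺ BigRemoved? (UniqueP.allFin⁺ _)))
    module Pk = Packed (pack-spec (ℚP.<⇒≤ 0<e) b 0ℚ smalls smalls-small
                         (UniqueP.filter⁺ SmallRemoved? (UniqueP.allFin⁺ _)) ℚP.≤-refl (ℚP.<⇒≤ 0<e))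

    pieces-cover : Covers (bigs ++ smalls) pieces
    pieces-cover = covers-++ bigs-apart St.covers Pk.covers

    pieces-ordered : AllPairs Ordered pieces
    pieces-ordered = Ordered-++ bigs-apart St.covers Pk.covers (All.map inj₁ St.below) Pk.starts St.ordered Pk.ordered

    pieces-fit : All Fits pieces
    pieces-fit = AllP.++⁺ St.fits Pk.fits

    module _ (load≤ : mstLoad μ δ T I ≤ ι m * e) where

      budget : ι b * e + sumℚ (map load smalls) ≤ ι m * e
      budget = begin
        ι b * e + sumℚ (map load smalls)
          ≤⟨ ℚP.+-monoˡ-≤ _ (sumℚ-≥-count load e (All.tabulate (proj₂ ∘ big))) ⟩
        sumℚ (map load bigs) + sumℚ (map load smalls)
          ≤⟨ sumℚ-filter-disjoint BigRemoved? SmallRemoved? (isMst? μ δ T ∘ lookup js) load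
               (λ big small → ℚP.<-irrefl refl (ℚP.<-≤-trans (proj₂ big) (proj₂ small)))
               (λ big → proj₁ (proj₁ big) , proj₁ (proj₂ (proj₁ big)))
               (λ small → proj₁ (proj₁ small) , proj₁ (proj₂ (proj₁ small)))
               load-nonNeg (allFin (length js)) ⟩
        sumℚ (map load (filter (isMst? μ δ T ∘ lookup js) (allFin (length js))))
          ≡⟨ trans (cong sumℚ (ListP.map-∘ (filter (isMst? μ δ T ∘ lookup js) (allFin (length js)))))
                   (cong (sumℚ ∘ map (λ x → setup x + proc x)) (filter-indices (isMst? μ δ T) js)) ⟩
        mstLoad μ δ T I
          ≤⟨ load≤ ⟩
        ι m * e ∎

      in-range : All (λ q → pmach q <ₙ m) pieces
      in-range = All.map (λ lt → ι-cancel-< (ℚP.*-cancelʳ-<-nonNeg e {{nonNegative (ℚP.<⇒≤ 0<e)}} (ℚP.<-≤-trans lt budget)))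
        (AllP.++⁺ (All.map stacked St.below) (All.map packed Pk.below))
        where
        stacked : ∀ {k} → k <ₙ b → ι k * e < ι b * e + sumℚ (map load smalls)
        stacked k<b = ℚP.<-≤-trans (ℚP.*-monoˡ-<-pos e {{positive 0<e}} (ι-mono-< k<b))
                        (≤-from-gap _ refl (sumℚ-nonNeg load (All.universal load-nonNeg smalls)))
        packed : ∀ {x} → x < ι b * e + 0ℚ + sumℚ (map load smalls) → x < ι b * e + sumℚ (map load smalls)
        packed = subst (_ <_) (cong (_+ sumℚ (map load smalls)) (ℚP.+-identityʳ (ι b * e)))

      toPart : (∃ λ q → pmach q <ₙ m) → Part I
      toPart (q , q<m) = part (pjob q) (pfrac q) (fromℕ< q<m) (pstart q)

      attached : List (∃ λ q → pmach q <ₙ m)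
      attached = All.toList in-range

      newParts : List (Part I)
      newParts = map toPart attached

      along : ∀ {P : Piece → Set} → All P pieces → All (P ∘ proj₁) attached
      along h = AllP.map⁻ (subst (All _) (sym (toList-proj₁ in-range)) h)

      ordered⇒compatible : ∀ {x y} → Ordered (proj₁ x) (proj₁ y) → Parts.Compatible (toPart x) (toPart y)
      ordered⇒compatible {q , q<m} {r , r<m} (q≼r , same-job) = same-mach q≼r , same-job
        where
        same-mach : (pmach q , pend q) ≼ (pmach r , pstart r) → fromℕ< q<m ≡ fromℕ< r<m →
                    Disjoint (toPart (q , q<m)) (toPart (r , r<m))
        same-mach (inj₁ q<r) eq = ⊥-elim (ℕP.<-irrefl
          (trans (sym (FinP.toℕ-fromℕ< q<m)) (trans (cong toℕ eq) (FinP.toℕ-fromℕ< r<m))) q<r)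
        same-mach (inj₂ (_ , end≤start)) _ = inj₁ end≤start

      newParts-share : ∀ j → Parts.share j newParts ≡ share j pieces
      newParts-share j = trans (share-map jx fx (job {I}) (frac {I}) toPart id id (λ _ → refl) (λ _ → refl) j attached)
        (trans (sym (share-map jx fx pjob pfrac proj₁ id id (λ _ → refl) (λ _ → refl) j attached))
               (cong (share j) (toList-proj₁ in-range)))
        where
        jx = pjob ∘ proj₁
        fx = pfrac ∘ proj₁

      removed⇒∈ : ∀ {j} → Removed (lookup js j) → j ∈ bigs ++ smalls
      removed⇒∈ {j} removed with e <? load j
      ... | yes e<v = ∈-++⁺ˡ (∈-filter⁺ BigRemoved? (∈-allFin j) (removed , e<v))
      ... | no e≮v  = ∈-++⁺ʳ bigs (∈-filter⁺ SmallRemoved? (∈-allFin j) (removed , ℚP.≮⇒≥ e≮v))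

      ∈⇒removed : ∀ {j} → j ∈ bigs ++ smalls → Removed (lookup js j)
      ∈⇒removed j∈ with ∈-++⁻ bigs j∈
      ... | inj₁ j∈bigs   = proj₁ (big j∈bigs)
      ... | inj₂ j∈smalls = proj₁ (small j∈smalls)

      e+d≡ : e + d ≡ (ε + δ) * T
      e+d≡ = sym (ℚP.*-distribʳ-+ T ε δ)

      extend : HasScheduleWithin I₁ T' → HasScheduleWithin I (T' + (ε + δ) * T)
      extend (ps₁ , S₁ , ends₁) = ps , Parts.lists⇒IsSchedule admissible compatible shares , Parts.within ends
        where
        oldParts = map relabel ps₁
        ps = oldParts ++ newParts
        lists₁ = ScheduleLists.IsSchedule⇒lists I₁ S₁
        old-ends : All (λ q → endT q ≤ T') oldParts
        old-ends = AllP.map⁺ (All.map (λ {q} h → subst (_≤ T') (sym (endT-relabel q)) h) (All-tabulateᶠ ps₁ ends₁))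
        new-starts : All (λ q → T' ≤ start q) newParts
        new-starts = AllP.map⁺ (All.map (proj₁ ∘ proj₂ ∘ proj₂) (along pieces-fit))
        admissible : All Parts.Admissible ps
        admissible = AllP.++⁺ (AllP.map⁺ (proj₁ lists₁))
          (AllP.map⁺ (All.map (λ (0<f , f≤1 , T'≤ , _) → 0<f , f≤1 , ℚP.≤-trans (ℚP.<⇒≤ 0<T') T'≤) (along pieces-fit)))
        compatible : AllPairs Parts.Compatible ps
        compatible = AllPairsP.++⁺
          (AllPairsP.map⁺ (AllPairs.map (λ {q} {r} → Compatible-relabel⁺ q r) (proj₂ lists₁)))
          (AllPairsP.map⁺ (AllPairs.map (λ {x} {y} → ordered⇒compatible {x} {y})
            (AllPairsP.map⁻ (subst (AllPairs Ordered) (sym (toList-proj₁ in-range)) pieces-ordered))))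
          (All-cross (λ end≤T' T'≤start → let sep = inj₁ (ℚP.≤-trans end≤T' T'≤start) in (λ _ → sep) , (λ _ → sep))
            old-ends new-starts)
        ends : All (λ q → endT q ≤ T' + (ε + δ) * T) ps
        ends = AllP.++⁺ (All.map (λ h → ℚP.≤-trans h T'≤) old-ends)
          (AllP.map⁺ (All.map (λ fits → subst (λ x → _ ≤ T' + x) e+d≡ (proj₂ (proj₂ (proj₂ fits)))) (along pieces-fit)))
          where
          T'≤ : T' ≤ T' + (ε + δ) * T
          T'≤ = ≤-from-gap _ refl (subst (0ℚ ≤_) e+d≡ (ℚP.<⇒≤ (ℚP.+-mono-< 0<e (0<x*y 0<δ 0<T))))
        by-origin : ∀ j → (∃ λ k → E k ≡ j) ⊎ ¬ ¬ Removed (lookup js j) →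
                    Parts.share j oldParts + share j pieces ≡ 1ℚ
        by-origin _ (inj₁ (k , refl)) = trans
          (cong₂ _+_ (trans (share-relabel k ps₁) (IsSchedule.fracSum S₁ k))
                     (share-uncovered pieces-cover (E-kept k ∘ ∈⇒removed)))
          (ℚP.+-identityʳ 1ℚ)
        by-origin j (inj₂ ¬kept) = trans
          (cong₂ _+_ (Parts.share-none j old-jobs)
                     (share≡1 pieces-cover (removed⇒∈ (decidable-stable (removed? ε μ δ T (lookup js j)) ¬kept))))
          (ℚP.+-identityˡ 1ℚ)
          where
          old-jobs : All (λ q → job q ≢ j) oldParts
          old-jobs = AllP.map⁺ (All.universal (λ q Eq≡j → ¬kept (subst (λ i → ¬ Removed (lookup js i)) Eq≡j (E-kept (job q)))) ps₁)
        shares : ∀ j → Parts.share j ps ≡ 1ℚ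
        shares j = trans (Parts.share-++ j oldParts newParts)
          (trans (cong (λ x → Parts.share j oldParts + x) (newParts-share j)) (by-origin j (E-or-rejected j)))

lemma15 : (I : Instance) → WellFormed I →
          (ε T δ : ℚ) → 0ℚ < ε → ε < 1ℚ → 0ℚ < T →
          (∃[ k ] ((1 Data.Nat.≤ k) × ((+ k / 1) * (ε * ε) ≤ (+ 2 / 1)) × (δ ≡ ε ^ k))) →
          let μ = (ε * ε) * δ
              I₁ = reduce ε μ δ T I in
          mstLoad μ δ T I ≤ (+ machines I / 1) * (ε * T) →
          (HasScheduleWithin I T → HasScheduleWithin I₁ T) ×
          (∀ (T' : ℚ) → 0ℚ < T' → HasScheduleWithin I₁ T' →
             HasScheduleWithin I (T' + (ε + δ) * T))
-- of the constraints on ε and δ only δ > 0 is needed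
lemma15 I wf ε T δ 0<ε _ 0<T (k , _ , _ , δ≡εᵏ) load≤ =
  restrict , λ T' 0<T' → Extend.extend T' 0<T' load≤
  where
  0<δ : 0ℚ < δ
  0<δ = subst (0ℚ <_) (sym δ≡εᵏ) (0<x^k 0<ε k)
  open Extension I wf ε T δ 0<ε 0<T 0<δ
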